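{- Reactive processes (the set $\{P \mid \mathbf{R}(P) = P\}$ of $\mathbf{R}$-healthy predicates) form a complete lattice ordered by refinement $\sqsubseteq$. For any $A \subseteq \{P \mid \mathbf{R}(P) = P\}$, the infimum of $A$ in this lattice is $\mathbf{R}(\bigvee A)$, i.e. $\mathbf{R}$ applied to the nondeterministic choice (disjunction) of the elements of $A$, and a supremum of $A$ also exists in the lattice.
   Context: Setting: Unifying Theories of Programming (UTP). Programs are relational predicates over unprimed (before) and primed (after) observational variables. Refinement $P \sqsubseteq Q$ means $Q$ refines $P$ (i.e. $Q \Rightarrow P$ universally); the refinement infimum of a set of predicates is their disjunction. Observational variables are $wait, wait' : \mathbb{B}$ and $tr, tr' : \mathcal{T}$, where $(\mathcal{T}, \frown, \varepsilon)$ is a trace algebra: an associative operation $\frown$ with two-sided unit $\varepsilon$, left- and right-cancellative, and with $x \frown y = \varepsilon \Rightarrow x = \varepsilon$. Prefix is $x \le y \iff \exists z.\ y = x \frown z$, and subtraction $y - x$ is the unique $z$ with $y = x \frown z$ if $x \le y$, and $\varepsilon$ otherwise. $\mathit{II}$ is the relational identity (all variables unchanged), and $P \lhd b \rhd Q \equiv (b \wedge P) \vee (\neg b \wedge Q)$. Healthiness conditions: $\mathbf{R1}(P) = P \wedge tr \le tr'$; $\mathbf{R2}_c(P) = P[\varepsilon, tr' - tr / tr, tr'] \lhd tr \le tr' \rhd P$; $\mathbf{R3}(P) = \mathit{II} \lhd wait \rhd P$; $\mathbf{R} = \mathbf{R3} \circ \mathbf{R2}_c \circ \mathbf{R1}$.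 It is known that $\mathbf{R}$ is idempotent and monotone with respect to $\sqsubseteq$. -}

module Defs where

open import Data.Bool using (Bool; true; false)
open import Data.Product using (Σ; ∃; _×_; _,_; proj₁; proj₂)
open import Data.Sum using (_⊎_; inj₁; inj₂)
open import Relation.Nullary using (¬_)
open import Relation.Binary.PropositionalEquality using (_≡_)

-- Subtraction y − x is carried as
-- an operation pinned down by its defining clauses (it is the unique z with
-- y = x ⌢ z when x ≤ y, and ε otherwise; uniqueness follows from
-- left-cancellativity).
record TraceAlgebra : Set₁ where
  infixr 5 _⌢_
  field
    Carrier  : Set
    _⌢_      : Carrier → Carrier → Carrier
    ε        : Carrier
    assoc    : ∀ x y z → (x ⌢ y) ⌢ z ≡ x ⌢ (y ⌢ z)
    identityˡ : ∀ x → ε ⌢ x ≡ x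
    identityʳ : ∀ x → x ⌢ ε ≡ x
    cancelˡ  : ∀ x y z → x ⌢ y ≡ x ⌢ z → y ≡ z
    cancelʳ  : ∀ x y z → y ⌢ x ≡ z ⌢ x → y ≡ z
    zero-sum : ∀ x y → x ⌢ y ≡ ε → x ≡ ε

  _≤_ : Carrier → Carrier → Set
  x ≤ y = ∃ λ z → y ≡ x ⌢ z

  field
    _−_      : Carrier → Carrier → Carrier
    −-prefix : ∀ x y → x ≤ y → y ≡ x ⌢ (y − x)
    −-other  : ∀ x y → ¬ (x ≤ y) → y − x ≡ ε

module UTP (𝒯 : TraceAlgebra) where
  open TraceAlgebra 𝒯

  -- an observation of the undashed (resp. dashed) variables: (wait , tr)
  State : Set
  State = Bool × Carrier

  wait : State → Bool
  wait = proj₁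

  tr : State → Carrier
  tr = proj₂

  Pred : Set₁
  Pred = State → State → Set

  _⊑_ : Pred → Pred → Set
  P ⊑ Q = ∀ s s' → Q s s' → P s s'

  _≐_ : Pred → Pred → Set
  P ≐ Q = ∀ s s' → (P s s' → Q s s') × (Q s s' → P s s')

  cond : (State → State → Set) → Pred → Pred → Pred
  cond b P Q s s' = (b s s' × P s s') ⊎ (¬ b s s' × Q s s')

  II : Pred
  II s s' = s' ≡ s

  R1 : Pred → Pred
  R1 P s s' = P s s' × (tr s ≤ tr s')

  R2c : Pred → Pred
  R2c P = cond (λ s s' → tr s ≤ tr s')
               (λ s s' → P (wait s , ε) (wait s' , (tr s' − tr s)))
               P

  R3 : Pred → Pred
  R3 P = cond (λ s s' → wait s ≡ true) II P

  R : Pred → Pred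
  R P = R3 (R2c (R1 P))

  Healthy : Pred → Set
  Healthy P = R P ≐ P

  ⋁ : {I : Set} → (I → Pred) → Pred
  ⋁ {I} A s s' = Σ I λ i → A i s s'

  IsHealthyInf : {I : Set} → (I → Pred) → Pred → Set₁
  IsHealthyInf {I} A X =
    Healthy X × (∀ i → X ⊑ A i) ×
    (∀ L → Healthy L → (∀ i → L ⊑ A i) → L ⊑ X)

  IsHealthySup : {I : Set} → (I → Pred) → Pred → Set₁
  IsHealthySup {I} A X =
    Healthy X × (∀ i → A i ⊑ X) ×
    (∀ U → Healthy U → (∀ i → A i ⊑ U) → X ⊑ U)

-- R is monotone and idempotent, so its healthy predicates are exactly its
-- image, and the image of a monotone idempotent operator on a complete
-- lattice is again a complete lattice: meets and joins are obtained by
-- applying the operator to the meets and joins of the ambient lattice.  In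
-- the refinement order the ambient infimum is disjunction and the ambient
-- supremum is conjunction.
module Submission where

open import Defs
open import Data.Product using (Σ; _×_; _,_; proj₁; proj₂)
open import Data.Sum using (inj₁; inj₂)
open import Data.Empty using (⊥-elim)
open import Relation.Binary.PropositionalEquality using (_≡_; sym; trans; subst)

module ReactiveProperties (𝒯 : TraceAlgebra) where
  open TraceAlgebra 𝒯
  open UTP 𝒯

  ε≤ : ∀ d → ε ≤ d
  ε≤ d = d , sym (identityˡ d)

  −-identityʳ : ∀ d → d − ε ≡ d
  −-identityʳ d = sym (trans (−-prefix ε d (ε≤ d)) (identityˡ (d − ε)))

  R-monotone : ∀ {P Q} → P ⊑ Q → R P ⊑ R Q
  R-monotone P⊑Q s s' (inj₁ waiting) = inj₁ waiting
  R-monotone P⊑Q s s' (inj₂ (¬wait , inj₁ (tr≤ , q , tr≤′))) =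
    inj₂ (¬wait , inj₁ (tr≤ , P⊑Q _ _ q , tr≤′))
  R-monotone P⊑Q s s' (inj₂ (¬wait , inj₂ (tr≰ , q , tr≤′))) =
    inj₂ (¬wait , inj₂ (tr≰ , P⊑Q _ _ q , tr≤′))

  -- After R2c the initial trace is ε, so a second R1/R2c sees ε ≤ tr' and
  -- subtracts nothing.
  R-idempotent : ∀ P → R (R P) ≐ R P
  R-idempotent P s s' = collapse , expand
    where
    P-after : Carrier → Carrier → Set
    P-after d e = P (wait s , ε) (wait s' , d) → P (wait s , ε) (wait s' , e)

    drop-ε : ∀ d → P-after (d − ε) d
    drop-ε d = subst (λ e → P (wait s , ε) (wait s' , e)) (−-identityʳ d)

    add-ε : ∀ d → P-after d (d − ε)
    add-ε d = subst (λ e → P (wait s , ε) (wait s' , e)) (sym (−-identityʳ d))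

    collapse : R (R P) s s' → R P s s'
    collapse (inj₁ waiting) = inj₁ waiting
    collapse (inj₂ (_ , inj₂ (tr≰ , _ , tr≤))) = ⊥-elim (tr≰ tr≤)
    collapse (inj₂ (¬wait , inj₁ (_ , inj₁ (wait , _) , _))) = ⊥-elim (¬wait wait)
    collapse (inj₂ (_ , inj₁ (_ , inj₂ (_ , inj₂ (ε≰ , _)) , _))) = ⊥-elim (ε≰ (ε≤ _))
    collapse (inj₂ (¬wait , inj₁ (tr≤ , inj₂ (_ , inj₁ (_ , p , _)) , _))) =
      inj₂ (¬wait , inj₁ (tr≤ , drop-ε _ p , ε≤ _))

    expand : R P s s' → R (R P) s s'
    expand (inj₁ waiting) = inj₁ waiting
    expand (inj₂ (_ , inj₂ (tr≰ , _ , tr≤))) = ⊥-elim (tr≰ tr≤)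
    expand (inj₂ (¬wait , inj₁ (tr≤ , p , _))) =
      inj₂ (¬wait , inj₁ (tr≤ , inj₂ (¬wait , inj₁ (ε≤ _ , add-ε _ p , ε≤ _)) , ε≤ _))

module MonotoneFixedPoints (𝒯 : TraceAlgebra) (F : UTP.Pred 𝒯 → UTP.Pred 𝒯)
    (F-monotone : ∀ {P Q} → UTP._⊑_ 𝒯 P Q → UTP._⊑_ 𝒯 (F P) (F Q)) where
  open UTP 𝒯

  ⋀ : {I : Set} → (I → Pred) → Pred
  ⋀ {I} A s s' = ∀ (i : I) → A i s s'

  Fixed : Pred → Set
  Fixed P = F P ≐ P

  module _ {I : Set} (A : I → Pred) where

    F-⋁-lower : (∀ i → Fixed (A i)) → ∀ i → F (⋁ A) ⊑ A i
    F-⋁-lower fixed i s s' a =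
      F-monotone (λ _ _ x → i , x) s s' (proj₂ (fixed i s s') a)

    F-⋁-greatest : ∀ L → Fixed L → (∀ i → L ⊑ A i) → L ⊑ F (⋁ A)
    F-⋁-greatest L fixed L⊑A s s' x =
      proj₁ (fixed s s') (F-monotone (λ t t' (i , y) → L⊑A i t t' y) s s' x)

    F-⋀-upper : (∀ i → Fixed (A i)) → ∀ i → A i ⊑ F (⋀ A)
    F-⋀-upper fixed i s s' x =
      proj₁ (fixed i s s') (F-monotone (λ _ _ all → all i) s s' x)

    F-⋀-least : ∀ U → Fixed U → (∀ i → A i ⊑ U) → F (⋀ A) ⊑ U
    F-⋀-least U fixed A⊑U s s' u =
      F-monotone (λ t t' v i → A⊑U i t t' v) s s' (proj₂ (fixed s s') u)

theorem9 : (𝒯 : TraceAlgebra) → let open UTP 𝒯 in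
    (I : Set) (A : I → Pred) → (∀ i → Healthy (A i)) →
    IsHealthyInf A (R (⋁ A)) × Σ Pred (λ S → IsHealthySup A S)
theorem9 𝒯 I A healthy =
  (R-idempotent (⋁ A) , F-⋁-lower A healthy , F-⋁-greatest A) ,
  (R (⋀ A) , R-idempotent (⋀ A) , F-⋀-upper A healthy , F-⋀-least A)
  where
  open UTP 𝒯
  open ReactiveProperties 𝒯
  open MonotoneFixedPoints 𝒯 R R-monotone
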